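{- Let $M$ be a $K\times K$ real matrix, let $X_1,\dots,X_k$ be a partition of $[K]$ into $k$ disjoint sets and $Y_1,\dots,Y_\ell$ a partition of $[K]$ into $\ell$ disjoint sets. Define the $K\times K$ matrix $N$ by $N_{x,y}=\frac{1}{|X_i|\cdot|Y_j|}\sum_{x'\in X_i,\,y'\in Y_j}M_{x',y'}$ whenever $x\in X_i$ and $y\in Y_j$. Then $\mathrm{Tr}\, MM^TMM^T=\mathrm{Tr}\, M^TMM^TM\ge\mathrm{Tr}\, NN^TNN^T=\mathrm{Tr}\, N^TNN^TN$. -}

module Defs where

open import Data.Nat as ℕ using (ℕ; zero; suc)
open import Data.Fin using (Fin; zero; suc; _≟_)
open import Data.Product using (∃)
open import Relation.Nullary using (does)
open import Data.Bool using (if_then_else_)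
open import Relation.Binary.PropositionalEquality using (_≡_; _≢_)
open import Algebra.Structures using (IsCommutativeRing)
open import Relation.Binary.Structures using (IsTotalOrder)

-- An ordered field (the real numbers ℝ are one; the statement is proved for
-- every ordered field, which contains the paper's real case).
record OrderedField : Set₁ where
  infixl 6 _+_
  infixl 7 _*_
  infix 4 _≤_
  field
    Carrier : Set
    _+_ _*_ : Carrier → Carrier → Carrier
    -_ : Carrier → Carrier
    0# 1# : Carrier
    _⁻¹ : Carrier → Carrier
    _≤_ : Carrier → Carrier → Set
    isCommutativeRing : IsCommutativeRing _≡_ _+_ _*_ -_ 0# 1#
    0≢1 : 0# ≢ 1#
    ⁻¹-inverse : ∀ x → x ≢ 0# → x * (x ⁻¹) ≡ 1#
    isTotalOrder : IsTotalOrder _≡_ _≤_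
    +-mono-≤ : ∀ {x y} z → x ≤ y → x + z ≤ y + z
    *-nonneg : ∀ {x y} → 0# ≤ x → 0# ≤ y → 0# ≤ x * y

module Mat (F : OrderedField) where
  open OrderedField F

  Matrix : ℕ → Set
  Matrix n = Fin n → Fin n → Carrier

  sum : ∀ n → (Fin n → Carrier) → Carrier
  sum zero f = 0#
  sum (suc n) f = f zero + sum n (λ i → f (suc i))

  fromℕ : ℕ → Carrier
  fromℕ zero = 0#
  fromℕ (suc n) = 1# + fromℕ n

  infixl 7 _⊗_
  _⊗_ : ∀ {n} → Matrix n → Matrix n → Matrix n
  _⊗_ {n} A B i j = sum n (λ t → A i t * B t j)

  _ᵀ : ∀ {n} → Matrix n → Matrix n
  (A ᵀ) i j = A j i

  Tr : ∀ {n} → Matrix n → Carrier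
  Tr {n} A = sum n (λ i → A i i)

  -- A partition of [K] into m (nonempty) parts X_0..X_{m-1} is encoded by the
  -- block-assignment map p : [K] → [m] (x ∈ X_i iff p x ≡ i), required to be
  -- surjective (every part nonempty).
  Surjective : ∀ {K m} → (Fin K → Fin m) → Set
  Surjective {K} {m} p = ∀ (i : Fin m) → ∃ λ (x : Fin K) → p x ≡ i

  card : ∀ {K m} → (Fin K → Fin m) → Fin m → ℕ
  card {zero} p i = zero
  card {suc K} p i =
    (if does (p zero ≟ i) then 1 else 0) ℕ.+ card {K} (λ x → p (suc x)) i

  blockSum : ∀ {K k l} → Matrix K → (Fin K → Fin k) → (Fin K → Fin l)
             → Fin k → Fin l → Carrier
  blockSum {K} M p q i j =
    sum K (λ x' → sum K (λ y' →
      if does (p x' ≟ i) then (if does (q y' ≟ j) then M x' y' else 0#) else 0#))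

  blockAvg : ∀ {K k l} → Matrix K → (Fin K → Fin k) → (Fin K → Fin l) → Matrix K
  blockAvg M p q x y =
    (fromℕ (card p (p x) ℕ.* card q (q y))) ⁻¹ * blockSum M p q (p x) (q y)

-- Averaging over the blocks of a partition is a sandwich N = P M Q, where P and Q average over the
-- blocks of p and q; these are symmetric idempotent matrices, i.e. orthogonal projections. The quantity
-- Tr (A Aᵀ A Aᵀ) is the squared Frobenius norm ‖A Aᵀ‖², and is invariant under A ↦ Aᵀ. An orthogonal
-- projection Q can only shrink Frobenius norms, ‖X Q‖² ≤ ‖X‖², because X = X Q + (X − X Q) is an
-- orthogonal decomposition. Hence ‖(A Q)ᵀ (A Q)‖² = ‖Q (Aᵀ A) Q‖² ≤ ‖Aᵀ A‖², i.e. multiplying A by a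
-- projection on the right does not increase Tr (A Aᵀ A Aᵀ); by transposition the same holds on the left.
module Submission where

open import Defs
open import Data.Nat using (ℕ)
open import Data.Fin using (Fin)
open import Data.Product using (_×_)
open import Relation.Binary.PropositionalEquality using (_≡_)

open import Algebra.Bundles using (CommutativeRing)
open import Data.Bool using (if_then_else_)
open import Data.Empty using (⊥-elim)
open import Data.Fin using (zero; suc; _≟_)
open import Data.Nat as ℕ using (z≤n; s≤s)
open import Data.Product using (_,_)
open import Data.Sum using (inj₁; inj₂)
open import Function using (_∘_)
open import Relation.Binary.Bundles using (Poset; Setoid)
open import Relation.Binary.PropositionalEquality
  using (refl; sym; trans; cong; cong₂; subst; _≢_; _≗_; module ≡-Reasoning)
open import Relation.Binary.Structures using (IsTotalOrder)
open import Relation.Nullary using (does; yes; no)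
import Algebra.Properties.AbelianGroup as AbelianGroupProperties
import Algebra.Properties.CommutativeSemigroup as CommutativeSemigroupProperties
import Algebra.Properties.Group as GroupProperties
import Algebra.Properties.Ring as RingProperties
import Algebra.Properties.Semiring.Mult as SemiringMultProperties
import Relation.Binary.Reasoning.PartialOrder as PartialOrderReasoning
import Relation.Binary.Reasoning.Setoid as SetoidReasoning

module BlockAveraging (F : OrderedField) where
  open OrderedField F
  open Mat F

  commutativeRing : CommutativeRing _ _
  commutativeRing = record { isCommutativeRing = isCommutativeRing }

  open CommutativeRing commutativeRing
    using ( +-assoc; +-comm; +-identityˡ; +-identityʳ; -‿inverseʳ
          ; +-commutativeSemigroup; +-group; +-abelianGroup
          ; *-assoc; *-comm; *-identityˡ; *-identityʳ; *-commutativeSemigroup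
          ; distribˡ; distribʳ; zeroˡ; zeroʳ; ring; semiring)
  open RingProperties ring using (-‿distribˡ-*; -‿distribʳ-*)
  open GroupProperties +-group using (⁻¹-involutive; identityʳ-unique)
  open AbelianGroupProperties +-abelianGroup using (xyx⁻¹≈y)
  open CommutativeSemigroupProperties +-commutativeSemigroup using (interchange)
  open CommutativeSemigroupProperties *-commutativeSemigroup
    using () renaming (interchange to *-interchange; xy∙z≈xz∙y to xy*z≡xz*y)
  open SemiringMultProperties semiring using (×1-homo-*) renaming (_×_ to _×′_)

  open IsTotalOrder isTotalOrder using (total; antisym) renaming (refl to ≤-refl)

  poset : Poset _ _ _
  poset = record { isPartialOrder = IsTotalOrder.isPartialOrder isTotalOrder }

  module ≤-Reasoning = PartialOrderReasoning poset

  x≤x+y : ∀ {x y} → 0# ≤ y → x ≤ x + y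
  x≤x+y {x} {y} 0≤y = begin
    x      ≡⟨ +-identityˡ x ⟨
    0# + x ≤⟨ +-mono-≤ x 0≤y ⟩
    y + x  ≡⟨ +-comm y x ⟩
    x + y  ∎
    where open ≤-Reasoning

  +-nonneg : ∀ {x y} → 0# ≤ x → 0# ≤ y → 0# ≤ x + y
  +-nonneg {x} {y} 0≤x 0≤y = begin
    0#     ≤⟨ 0≤x ⟩
    x      ≤⟨ x≤x+y 0≤y ⟩
    x + y  ∎
    where open ≤-Reasoning

  -x*-x≡x*x : ∀ x → (- x) * (- x) ≡ x * x
  -x*-x≡x*x x = begin
    (- x) * (- x)  ≡⟨ -‿distribʳ-* (- x) x ⟨
    - ((- x) * x)  ≡⟨ cong -_ (-‿distribˡ-* x x) ⟨
    - (- (x * x))  ≡⟨ ⁻¹-involutive (x * x) ⟩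
    x * x          ∎
    where open ≡-Reasoning

  x≤0⇒0≤-x : ∀ {x} → x ≤ 0# → 0# ≤ - x
  x≤0⇒0≤-x {x} x≤0 = begin
    0#        ≡⟨ -‿inverseʳ x ⟨
    x + - x   ≤⟨ +-mono-≤ (- x) x≤0 ⟩
    0# + - x  ≡⟨ +-identityˡ (- x) ⟩
    - x       ∎
    where open ≤-Reasoning

  x*x-nonneg : ∀ x → 0# ≤ x * x
  x*x-nonneg x with total 0# x
  ... | inj₁ 0≤x = *-nonneg 0≤x 0≤x
  ... | inj₂ x≤0 = subst (0# ≤_) (-x*-x≡x*x x) (*-nonneg 0≤-x 0≤-x)
    where 0≤-x = x≤0⇒0≤-x x≤0

  0≤1 : 0# ≤ 1#
  0≤1 = subst (0# ≤_) (*-identityˡ 1#) (x*x-nonneg 1#)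

  fromℕ-nonneg : ∀ n → 0# ≤ fromℕ n
  fromℕ-nonneg ℕ.zero = ≤-refl
  fromℕ-nonneg (ℕ.suc n) = +-nonneg 0≤1 (fromℕ-nonneg n)

  fromℕ-pos : ∀ {n} → 0 ℕ.< n → fromℕ n ≢ 0#
  fromℕ-pos {ℕ.suc n} _ 1+n≡0 = 0≢1 (antisym 0≤1 1≤0)
    where
    1≤0 : 1# ≤ 0#
    1≤0 = subst (1# ≤_) 1+n≡0 (x≤x+y (fromℕ-nonneg n))

  fromℕ≡×1# : ∀ n → fromℕ n ≡ n ×′ 1#
  fromℕ≡×1# ℕ.zero = refl
  fromℕ≡×1# (ℕ.suc n) = cong (1# +_) (fromℕ≡×1# n)

  fromℕ-* : ∀ m n → fromℕ (m ℕ.* n) ≡ fromℕ m * fromℕ n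
  fromℕ-* m n = begin
    fromℕ (m ℕ.* n)         ≡⟨ fromℕ≡×1# (m ℕ.* n) ⟩
    (m ℕ.* n) ×′ 1#         ≡⟨ ×1-homo-* m n ⟩
    (m ×′ 1#) * (n ×′ 1#)   ≡⟨ cong₂ _*_ (fromℕ≡×1# m) (fromℕ≡×1# n) ⟨
    fromℕ m * fromℕ n       ∎
    where open ≡-Reasoning

  -- No hypothesis x ≢ 0# is needed: x * y ≡ 1# rules it out.
  ⁻¹-unique : ∀ {x y} → x * y ≡ 1# → x ⁻¹ ≡ y
  ⁻¹-unique {x} {y} xy≡1 = begin
    x ⁻¹             ≡⟨ *-identityʳ (x ⁻¹) ⟨
    x ⁻¹ * 1#        ≡⟨ cong (x ⁻¹ *_) xy≡1 ⟨
    x ⁻¹ * (x * y)   ≡⟨ *-assoc (x ⁻¹) x y ⟨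
    (x ⁻¹ * x) * y   ≡⟨ cong (_* y) (trans (*-comm (x ⁻¹) x) (⁻¹-inverse x x≢0)) ⟩
    1# * y           ≡⟨ *-identityˡ y ⟩
    y                ∎
    where
    open ≡-Reasoning
    x≢0 : x ≢ 0#
    x≢0 refl = 0≢1 (trans (sym (zeroˡ y)) xy≡1)

  ⁻¹-distrib-* : ∀ {x y} → x ≢ 0# → y ≢ 0# → (x * y) ⁻¹ ≡ x ⁻¹ * y ⁻¹
  ⁻¹-distrib-* {x} {y} x≢0 y≢0 = ⁻¹-unique (begin
    (x * y) * (x ⁻¹ * y ⁻¹)    ≡⟨ *-interchange x y (x ⁻¹) (y ⁻¹) ⟩
    (x * x ⁻¹) * (y * y ⁻¹)    ≡⟨ cong₂ _*_ (⁻¹-inverse x x≢0) (⁻¹-inverse y y≢0) ⟩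
    1# * 1#                    ≡⟨ *-identityˡ 1# ⟩
    1#                         ∎)
    where open ≡-Reasoning

  sum-cong : ∀ n {f g : Fin n → Carrier} → f ≗ g → sum n f ≡ sum n g
  sum-cong ℕ.zero f≗g = refl
  sum-cong (ℕ.suc n) f≗g = cong₂ _+_ (f≗g zero) (sum-cong n (f≗g ∘ suc))

  sum-zero : ∀ n → sum n (λ _ → 0#) ≡ 0#
  sum-zero ℕ.zero = refl
  sum-zero (ℕ.suc n) = trans (cong (0# +_) (sum-zero n)) (+-identityˡ 0#)

  sum-distrib-+ : ∀ n (f g : Fin n → Carrier) → sum n (λ i → f i + g i) ≡ sum n f + sum n g
  sum-distrib-+ ℕ.zero f g = sym (+-identityˡ 0#)
  sum-distrib-+ (ℕ.suc n) f g =
    trans (cong (f zero + g zero +_) (sum-distrib-+ n (f ∘ suc) (g ∘ suc))) (interchange _ _ _ _)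

  *-distribˡ-sum : ∀ n x (f : Fin n → Carrier) → x * sum n f ≡ sum n (λ i → x * f i)
  *-distribˡ-sum ℕ.zero x f = zeroʳ x
  *-distribˡ-sum (ℕ.suc n) x f =
    trans (distribˡ x _ _) (cong (x * f zero +_) (*-distribˡ-sum n x (f ∘ suc)))

  *-distribʳ-sum : ∀ n x (f : Fin n → Carrier) → sum n f * x ≡ sum n (λ i → f i * x)
  *-distribʳ-sum ℕ.zero x f = zeroˡ x
  *-distribʳ-sum (ℕ.suc n) x f =
    trans (distribʳ x _ _) (cong (f zero * x +_) (*-distribʳ-sum n x (f ∘ suc)))

  sum-comm : ∀ m n (f : Fin m → Fin n → Carrier) →
             sum m (λ i → sum n (f i)) ≡ sum n (λ j → sum m (λ i → f i j))
  sum-comm ℕ.zero n f = sym (sum-zero n)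
  sum-comm (ℕ.suc m) n f =
    trans (cong (sum n (f zero) +_) (sum-comm m n (f ∘ suc))) (sym (sum-distrib-+ n _ _))

  sum-nonneg : ∀ n (f : Fin n → Carrier) → (∀ i → 0# ≤ f i) → 0# ≤ sum n f
  sum-nonneg ℕ.zero f _ = ≤-refl
  sum-nonneg (ℕ.suc n) f 0≤f = +-nonneg (0≤f zero) (sum-nonneg n (f ∘ suc) (0≤f ∘ suc))

  infix 4 _≈ₘ_
  _≈ₘ_ : ∀ {n} → Matrix n → Matrix n → Set
  A ≈ₘ B = ∀ i j → A i j ≡ B i j

  ≈ₘ-refl : ∀ {n} {A : Matrix n} → A ≈ₘ A
  ≈ₘ-refl i j = refl

  ≈ₘ-setoid : ℕ → Setoid _ _
  ≈ₘ-setoid n = record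
    { Carrier = Matrix n
    ; _≈_ = _≈ₘ_
    ; isEquivalence = record
      { refl = ≈ₘ-refl
      ; sym = λ A≈B i j → sym (A≈B i j)
      ; trans = λ A≈B B≈C i j → trans (A≈B i j) (B≈C i j)
      }
    }

  module ≈ₘ-Reasoning {n} = SetoidReasoning (≈ₘ-setoid n)

  ᵀ-cong : ∀ {n} {A B : Matrix n} → A ≈ₘ B → A ᵀ ≈ₘ B ᵀ
  ᵀ-cong A≈B i j = A≈B j i

  ⊗-cong : ∀ {n} {A A′ B B′ : Matrix n} → A ≈ₘ A′ → B ≈ₘ B′ → A ⊗ B ≈ₘ A′ ⊗ B′
  ⊗-cong {n} A≈A′ B≈B′ i j = sum-cong n (λ t → cong₂ _*_ (A≈A′ i t) (B≈B′ t j))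

  ⊗-assoc : ∀ {n} (A B C : Matrix n) → (A ⊗ B) ⊗ C ≈ₘ A ⊗ (B ⊗ C)
  ⊗-assoc {n} A B C i j = begin
    sum n (λ t → sum n (λ s → A i s * B s t) * C t j)
      ≡⟨ sum-cong n (λ t → *-distribʳ-sum n (C t j) _) ⟩
    sum n (λ t → sum n (λ s → A i s * B s t * C t j))
      ≡⟨ sum-comm n n _ ⟩
    sum n (λ s → sum n (λ t → A i s * B s t * C t j))
      ≡⟨ sum-cong n (λ s → sum-cong n (λ t → *-assoc (A i s) (B s t) (C t j))) ⟩
    sum n (λ s → sum n (λ t → A i s * (B s t * C t j)))
      ≡⟨ sum-cong n (λ s → *-distribˡ-sum n (A i s) _) ⟨
    sum n (λ s → A i s * sum n (λ t → B s t * C t j))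
      ∎
    where open ≡-Reasoning

  ᵀ-⊗ : ∀ {n} (A B : Matrix n) → (A ⊗ B) ᵀ ≈ₘ B ᵀ ⊗ A ᵀ
  ᵀ-⊗ {n} A B i j = sum-cong n (λ t → *-comm (A j t) (B t i))

  Tr-cong : ∀ {n} {A B : Matrix n} → A ≈ₘ B → Tr A ≡ Tr B
  Tr-cong {n} A≈B = sum-cong n (λ i → A≈B i i)

  Tr-⊗-comm : ∀ {n} (A B : Matrix n) → Tr (A ⊗ B) ≡ Tr (B ⊗ A)
  Tr-⊗-comm {n} A B =
    trans (sum-comm n n _) (sum-cong n (λ i → sum-cong n (λ t → *-comm (A t i) (B i t))))

  infixl 6 _⊕_ _⊖_
  _⊕_ _⊖_ : ∀ {n} → Matrix n → Matrix n → Matrix n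
  (A ⊕ B) i j = A i j + B i j
  (A ⊖ B) i j = A i j + - B i j

  ⊕-⊖-cancel : ∀ {n} (A B : Matrix n) → B ⊕ (A ⊖ B) ≈ₘ A
  ⊕-⊖-cancel A B i j = trans (sym (+-assoc (B i j) (A i j) (- B i j))) (xyx⁻¹≈y (B i j) (A i j))

  -- Unfolds definitionally to Σᵢ Σⱼ Aᵢⱼ Bᵢⱼ.
  ⟪_,_⟫ : ∀ {n} → Matrix n → Matrix n → Carrier
  ⟪ A , B ⟫ = Tr (A ⊗ B ᵀ)

  ‖_‖² : ∀ {n} → Matrix n → Carrier
  ‖ A ‖² = ⟪ A , A ⟫

  ⟪⟫-comm : ∀ {n} (A B : Matrix n) → ⟪ A , B ⟫ ≡ ⟪ B , A ⟫
  ⟪⟫-comm {n} A B = sum-cong n (λ i → sum-cong n (λ j → *-comm (A i j) (B i j)))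

  ⟪⟫-congʳ : ∀ {n} (A : Matrix n) {B B′ : Matrix n} → B ≈ₘ B′ → ⟪ A , B ⟫ ≡ ⟪ A , B′ ⟫
  ⟪⟫-congʳ A B≈B′ = Tr-cong (⊗-cong ≈ₘ-refl (ᵀ-cong B≈B′))

  ⟪⟫-distribʳ-⊕ : ∀ {n} (A B C : Matrix n) → ⟪ A , B ⊕ C ⟫ ≡ ⟪ A , B ⟫ + ⟪ A , C ⟫
  ⟪⟫-distribʳ-⊕ {n} A B C =
    trans (sum-cong n (λ i → trans (sum-cong n (λ j → distribˡ (A i j) (B i j) (C i j)))
                                   (sum-distrib-+ n _ _)))
          (sum-distrib-+ n _ _)

  ⟪⟫-distribˡ-⊕ : ∀ {n} (A B C : Matrix n) → ⟪ A ⊕ B , C ⟫ ≡ ⟪ A , C ⟫ + ⟪ B , C ⟫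
  ⟪⟫-distribˡ-⊕ A B C = begin
    ⟪ A ⊕ B , C ⟫          ≡⟨ ⟪⟫-comm (A ⊕ B) C ⟩
    ⟪ C , A ⊕ B ⟫          ≡⟨ ⟪⟫-distribʳ-⊕ C A B ⟩
    ⟪ C , A ⟫ + ⟪ C , B ⟫  ≡⟨ cong₂ _+_ (⟪⟫-comm C A) (⟪⟫-comm C B) ⟩
    ⟪ A , C ⟫ + ⟪ B , C ⟫  ∎
    where open ≡-Reasoning

  ‖‖²-nonneg : ∀ {n} (A : Matrix n) → 0# ≤ ‖ A ‖²
  ‖‖²-nonneg {n} A = sum-nonneg n _ (λ i → sum-nonneg n _ (λ j → x*x-nonneg (A i j)))

  ‖‖²-cong : ∀ {n} {A B : Matrix n} → A ≈ₘ B → ‖ A ‖² ≡ ‖ B ‖²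
  ‖‖²-cong A≈B = Tr-cong (⊗-cong A≈B (ᵀ-cong A≈B))

  ‖‖²-ᵀ : ∀ {n} (A : Matrix n) → ‖ A ᵀ ‖² ≡ ‖ A ‖²
  ‖‖²-ᵀ {n} A = sum-comm n n _

  pythagoras : ∀ {n} (A B : Matrix n) → ⟪ A , B ⟫ ≡ 0# → ‖ A ⊕ B ‖² ≡ ‖ A ‖² + ‖ B ‖²
  pythagoras A B A⊥B = begin
    ‖ A ⊕ B ‖²
      ≡⟨ ⟪⟫-distribʳ-⊕ (A ⊕ B) A B ⟩
    ⟪ A ⊕ B , A ⟫ + ⟪ A ⊕ B , B ⟫
      ≡⟨ cong₂ _+_ (⟪⟫-distribˡ-⊕ A B A) (⟪⟫-distribˡ-⊕ A B B) ⟩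
    (‖ A ‖² + ⟪ B , A ⟫) + (⟪ A , B ⟫ + ‖ B ‖²)
      ≡⟨ cong₂ (λ x y → (‖ A ‖² + x) + (y + ‖ B ‖²)) (trans (⟪⟫-comm B A) A⊥B) A⊥B ⟩
    (‖ A ‖² + 0#) + (0# + ‖ B ‖²)
      ≡⟨ cong₂ _+_ (+-identityʳ _) (+-identityˡ _) ⟩
    ‖ A ‖² + ‖ B ‖²
      ∎
    where open ≡-Reasoning

  -- The hypothesis says A ⊥ B ⊖ A, so B = A ⊕ (B ⊖ A) is an orthogonal decomposition.
  ‖A‖²≡⟪A,B⟫⇒‖A‖²≤‖B‖² : ∀ {n} (A B : Matrix n) → ‖ A ‖² ≡ ⟪ A , B ⟫ → ‖ A ‖² ≤ ‖ B ‖²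
  ‖A‖²≡⟪A,B⟫⇒‖A‖²≤‖B‖² A B ‖A‖²≡⟪A,B⟫ = begin
    ‖ A ‖²                  ≤⟨ x≤x+y (‖‖²-nonneg (B ⊖ A)) ⟩
    ‖ A ‖² + ‖ B ⊖ A ‖²     ≡⟨ pythagoras A (B ⊖ A) A⊥B⊖A ⟨
    ‖ A ⊕ (B ⊖ A) ‖²        ≡⟨ ‖‖²-cong (⊕-⊖-cancel B A) ⟩
    ‖ B ‖²                  ∎
    where
    open ≤-Reasoning
    A⊥B⊖A : ⟪ A , B ⊖ A ⟫ ≡ 0#
    A⊥B⊖A = identityʳ-unique ‖ A ‖² ⟪ A , B ⊖ A ⟫ (begin-equality
      ‖ A ‖² + ⟪ A , B ⊖ A ⟫  ≡⟨ ⟪⟫-distribʳ-⊕ A A (B ⊖ A) ⟨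
      ⟪ A , A ⊕ (B ⊖ A) ⟫     ≡⟨ ⟪⟫-congʳ A (⊕-⊖-cancel B A) ⟩
      ⟪ A , B ⟫               ≡⟨ ‖A‖²≡⟪A,B⟫ ⟨
      ‖ A ‖²                  ∎)

  record IsOrthogonalProjection {n} (Q : Matrix n) : Set where
    field
      symmetric  : Q ᵀ ≈ₘ Q
      idempotent : Q ⊗ Q ≈ₘ Q

  quartic : ∀ {n} → Matrix n → Carrier
  quartic A = Tr (A ⊗ A ᵀ ⊗ A ⊗ A ᵀ)

  quartic-cong : ∀ {n} {A B : Matrix n} → A ≈ₘ B → quartic A ≡ quartic B
  quartic-cong A≈B = Tr-cong (⊗-cong (⊗-cong (⊗-cong A≈B (ᵀ-cong A≈B)) A≈B) (ᵀ-cong A≈B))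

  quartic≡‖AAᵀ‖² : ∀ {n} (A : Matrix n) → quartic A ≡ ‖ A ⊗ A ᵀ ‖²
  quartic≡‖AAᵀ‖² A = Tr-cong (begin
    A ⊗ A ᵀ ⊗ A ⊗ A ᵀ           ≈⟨ ⊗-assoc (A ⊗ A ᵀ) A (A ᵀ) ⟩
    (A ⊗ A ᵀ) ⊗ (A ⊗ A ᵀ)       ≈⟨ ⊗-cong ≈ₘ-refl (ᵀ-⊗ A (A ᵀ)) ⟨
    (A ⊗ A ᵀ) ⊗ (A ⊗ A ᵀ) ᵀ     ∎)
    where open ≈ₘ-Reasoning

  quartic-ᵀ : ∀ {n} (A : Matrix n) → quartic (A ᵀ) ≡ quartic A
  quartic-ᵀ A = sym (trans (Tr-⊗-comm (A ⊗ A ᵀ ⊗ A) (A ᵀ)) (Tr-cong (begin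
    A ᵀ ⊗ (A ⊗ A ᵀ ⊗ A)        ≈⟨ ⊗-assoc (A ᵀ) (A ⊗ A ᵀ) A ⟨
    A ᵀ ⊗ (A ⊗ A ᵀ) ⊗ A        ≈⟨ ⊗-cong (⊗-assoc (A ᵀ) A (A ᵀ)) ≈ₘ-refl ⟨
    A ᵀ ⊗ A ⊗ A ᵀ ⊗ A          ∎)))
    where open ≈ₘ-Reasoning

  module _ {n} {Q : Matrix n} (isProj : IsOrthogonalProjection Q) where
    open IsOrthogonalProjection isProj

    ‖‖²-⊗-projʳ : ∀ X → ‖ X ⊗ Q ‖² ≤ ‖ X ‖²
    ‖‖²-⊗-projʳ X = ‖A‖²≡⟪A,B⟫⇒‖A‖²≤‖B‖² (X ⊗ Q) X (Tr-cong (begin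
      (X ⊗ Q) ⊗ (X ⊗ Q) ᵀ     ≈⟨ ⊗-cong ≈ₘ-refl (ᵀ-⊗ X Q) ⟩
      (X ⊗ Q) ⊗ (Q ᵀ ⊗ X ᵀ)   ≈⟨ ⊗-cong ≈ₘ-refl (⊗-cong symmetric ≈ₘ-refl) ⟩
      (X ⊗ Q) ⊗ (Q ⊗ X ᵀ)     ≈⟨ ⊗-assoc (X ⊗ Q) Q (X ᵀ) ⟨
      (X ⊗ Q) ⊗ Q ⊗ X ᵀ       ≈⟨ ⊗-cong (⊗-assoc X Q Q) ≈ₘ-refl ⟩
      X ⊗ (Q ⊗ Q) ⊗ X ᵀ       ≈⟨ ⊗-cong (⊗-cong ≈ₘ-refl idempotent) ≈ₘ-refl ⟩
      X ⊗ Q ⊗ X ᵀ             ∎))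
      where open ≈ₘ-Reasoning

    ‖‖²-⊗-projˡ : ∀ X → ‖ Q ⊗ X ‖² ≤ ‖ X ‖²
    ‖‖²-⊗-projˡ X = begin
      ‖ Q ⊗ X ‖²        ≡⟨ ‖‖²-ᵀ (Q ⊗ X) ⟨
      ‖ (Q ⊗ X) ᵀ ‖²    ≡⟨ ‖‖²-cong (ᵀ-⊗ Q X) ⟩
      ‖ X ᵀ ⊗ Q ᵀ ‖²    ≡⟨ ‖‖²-cong (⊗-cong ≈ₘ-refl symmetric) ⟩
      ‖ X ᵀ ⊗ Q ‖²      ≤⟨ ‖‖²-⊗-projʳ (X ᵀ) ⟩
      ‖ X ᵀ ‖²          ≡⟨ ‖‖²-ᵀ X ⟩
      ‖ X ‖²            ∎
      where open ≤-Reasoning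

    ᵀ⊗-gram-projʳ : ∀ A → (A ⊗ Q) ᵀ ⊗ (A ⊗ Q) ≈ₘ Q ⊗ (A ᵀ ⊗ A ⊗ Q)
    ᵀ⊗-gram-projʳ A = begin
      (A ⊗ Q) ᵀ ⊗ (A ⊗ Q)        ≈⟨ ⊗-cong (ᵀ-⊗ A Q) ≈ₘ-refl ⟩
      Q ᵀ ⊗ A ᵀ ⊗ (A ⊗ Q)        ≈⟨ ⊗-cong (⊗-cong symmetric ≈ₘ-refl) ≈ₘ-refl ⟩
      Q ⊗ A ᵀ ⊗ (A ⊗ Q)          ≈⟨ ⊗-assoc Q (A ᵀ) (A ⊗ Q) ⟩
      Q ⊗ (A ᵀ ⊗ (A ⊗ Q))        ≈⟨ ⊗-cong ≈ₘ-refl (⊗-assoc (A ᵀ) A Q) ⟨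
      Q ⊗ (A ᵀ ⊗ A ⊗ Q)          ∎
      where open ≈ₘ-Reasoning

    quartic-⊗-projʳ : ∀ A → quartic (A ⊗ Q) ≤ quartic A
    quartic-⊗-projʳ A = begin
      quartic (A ⊗ Q)                   ≡⟨ quartic-ᵀ (A ⊗ Q) ⟨
      quartic ((A ⊗ Q) ᵀ)               ≡⟨ quartic≡‖AAᵀ‖² ((A ⊗ Q) ᵀ) ⟩
      ‖ (A ⊗ Q) ᵀ ⊗ (A ⊗ Q) ‖²          ≡⟨ ‖‖²-cong (ᵀ⊗-gram-projʳ A) ⟩
      ‖ Q ⊗ (A ᵀ ⊗ A ⊗ Q) ‖²            ≤⟨ ‖‖²-⊗-projˡ (A ᵀ ⊗ A ⊗ Q) ⟩
      ‖ A ᵀ ⊗ A ⊗ Q ‖²                  ≤⟨ ‖‖²-⊗-projʳ (A ᵀ ⊗ A) ⟩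
      ‖ A ᵀ ⊗ A ‖²                      ≡⟨ quartic≡‖AAᵀ‖² (A ᵀ) ⟨
      quartic (A ᵀ)                     ≡⟨ quartic-ᵀ A ⟩
      quartic A                         ∎
      where open ≤-Reasoning

    quartic-⊗-projˡ : ∀ A → quartic (Q ⊗ A) ≤ quartic A
    quartic-⊗-projˡ A = begin
      quartic (Q ⊗ A)          ≡⟨ quartic-ᵀ (Q ⊗ A) ⟨
      quartic ((Q ⊗ A) ᵀ)      ≡⟨ quartic-cong (ᵀ-⊗ Q A) ⟩
      quartic (A ᵀ ⊗ Q ᵀ)      ≡⟨ quartic-cong (⊗-cong ≈ₘ-refl symmetric) ⟩
      quartic (A ᵀ ⊗ Q)        ≤⟨ quartic-⊗-projʳ (A ᵀ) ⟩
      quartic (A ᵀ)            ≡⟨ quartic-ᵀ A ⟩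
      quartic A                ∎
      where open ≤-Reasoning

  sum-indicator : ∀ {K m} (p : Fin K → Fin m) i a →
                  sum K (λ x → if does (p x ≟ i) then a else 0#) ≡ fromℕ (card p i) * a
  sum-indicator {ℕ.zero} p i a = sym (zeroˡ a)
  sum-indicator {ℕ.suc K} p i a with p zero ≟ i
  ... | yes _ = trans (cong (a +_) (sum-indicator (p ∘ suc) i a))
                      (sym (trans (distribʳ a 1# c) (cong (_+ c * a) (*-identityˡ a))))
    where c = fromℕ (card (p ∘ suc) i)
  ... | no _  = trans (+-identityˡ _) (sum-indicator (p ∘ suc) i a)

  card-self-pos : ∀ {K m} (p : Fin K → Fin m) x → 0 ℕ.< card p (p x)
  card-self-pos p zero with p zero ≟ p zero
  ... | yes _     = s≤s z≤n
  ... | no p0≢p0  = ⊥-elim (p0≢p0 refl)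
  card-self-pos p (suc x) with p zero ≟ p (suc x)
  ... | yes _ = s≤s z≤n
  ... | no _  = card-self-pos (p ∘ suc) x

  module BlockProjection {K m} (p : Fin K → Fin m) where
    weight : Fin m → Carrier
    weight i = fromℕ (card p i) ⁻¹

    block : Fin m → Fin K → Carrier
    block i y = if does (p y ≟ i) then weight i else 0#

    avg : Matrix K
    avg x = block (p x)

    sum-avg : ∀ x → sum K (avg x) ≡ 1#
    sum-avg x = trans (sum-indicator p (p x) (weight (p x)))
                      (⁻¹-inverse _ (fromℕ-pos (card-self-pos p x)))

    avg-symmetric : avg ᵀ ≈ₘ avg
    avg-symmetric x y with p x ≟ p y | p y ≟ p x
    ... | yes px≡py | yes _    = cong weight (sym px≡py)
    ... | yes px≡py | no py≢px = ⊥-elim (py≢px (sym px≡py))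
    ... | no px≢py  | yes py≡px = ⊥-elim (px≢py (sym py≡px))
    ... | no _      | no _      = refl

    avg-absorb : ∀ x y z → avg x y * avg y z ≡ avg x y * avg x z
    avg-absorb x y z with p y ≟ p x
    ... | yes py≡px = cong (λ i → weight (p x) * block i z) py≡px
    ... | no _      = trans (zeroˡ _) (sym (zeroˡ _))

    avg-idempotent : avg ⊗ avg ≈ₘ avg
    avg-idempotent x z = begin
      sum K (λ y → avg x y * avg y z)  ≡⟨ sum-cong K (λ y → avg-absorb x y z) ⟩
      sum K (λ y → avg x y * avg x z)  ≡⟨ *-distribʳ-sum K (avg x z) (avg x) ⟨
      sum K (avg x) * avg x z          ≡⟨ cong (_* avg x z) (sum-avg x) ⟩
      1# * avg x z                     ≡⟨ *-identityˡ (avg x z) ⟩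
      avg x z                          ∎
      where open ≡-Reasoning

    isOrthogonalProjection : IsOrthogonalProjection avg
    isOrthogonalProjection = record { symmetric = avg-symmetric ; idempotent = avg-idempotent }

  open BlockProjection using (weight; block; avg; avg-symmetric; isOrthogonalProjection)

  module _ {K k l} (M : Matrix K) (p : Fin K → Fin k) (q : Fin K → Fin l) where

    -- blockSum M p q i j unfolds to Σₓ Σᵧ masked i j x y.
    masked : Fin k → Fin l → Fin K → Fin K → Carrier
    masked i j x y = if does (p x ≟ i) then (if does (q y ≟ j) then M x y else 0#) else 0#

    weighted-masked≡block*M*block : ∀ i j x′ y′ →
      weight p i * weight q j * masked i j x′ y′ ≡ block p i x′ * M x′ y′ * block q j y′
    weighted-masked≡block*M*block i j x′ y′ with p x′ ≟ i | q y′ ≟ j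
    ... | yes _ | yes _ = xy*z≡xz*y (weight p i) (weight q j) (M x′ y′)
    ... | yes _ | no _  = trans (zeroʳ _) (sym (zeroʳ _))
    ... | no _  | yes _ = trans (zeroʳ _) (sym (trans (cong (_* weight q j) (zeroˡ (M x′ y′))) (zeroˡ _)))
    ... | no _  | no _  = trans (zeroʳ _) (sym (zeroʳ _))

    blockAvg≈avg⊗M⊗avg : blockAvg M p q ≈ₘ avg p ⊗ M ⊗ avg q
    blockAvg≈avg⊗M⊗avg x y = begin
      fromℕ (card p i ℕ.* card q j) ⁻¹ * blockSum M p q i j
        ≡⟨ cong (_* blockSum M p q i j) weight-product ⟩
      c * d * sum K (λ x′ → sum K (masked i j x′))
        ≡⟨ *-distribˡ-sum K (c * d) _ ⟩
      sum K (λ x′ → c * d * sum K (masked i j x′))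
        ≡⟨ sum-cong K (λ x′ → *-distribˡ-sum K (c * d) (masked i j x′)) ⟩
      sum K (λ x′ → sum K (λ y′ → c * d * masked i j x′ y′))
        ≡⟨ sum-cong K (λ x′ → sum-cong K (weighted-masked≡block*M*block i j x′)) ⟩
      sum K (λ x′ → sum K (λ y′ → avg p x x′ * M x′ y′ * avg q y y′))
        ≡⟨ sum-comm K K _ ⟩
      sum K (λ y′ → sum K (λ x′ → avg p x x′ * M x′ y′ * avg q y y′))
        ≡⟨ sum-cong K (λ y′ → sum-cong K (λ x′ →
             cong (avg p x x′ * M x′ y′ *_) (avg-symmetric q y′ y))) ⟩
      sum K (λ y′ → sum K (λ x′ → avg p x x′ * M x′ y′ * avg q y′ y))
        ≡⟨ sum-cong K (λ y′ → *-distribʳ-sum K (avg q y′ y) _) ⟨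
      sum K (λ y′ → sum K (λ x′ → avg p x x′ * M x′ y′) * avg q y′ y)
        ∎
      where
      open ≡-Reasoning
      i = p x
      j = q y
      c = weight p i
      d = weight q j
      weight-product : fromℕ (card p i ℕ.* card q j) ⁻¹ ≡ c * d
      weight-product =
        trans (cong _⁻¹ (fromℕ-* (card p i) (card q j)))
              (⁻¹-distrib-* (fromℕ-pos (card-self-pos p x)) (fromℕ-pos (card-self-pos q y)))

    quartic-blockAvg-≤ : quartic (blockAvg M p q) ≤ quartic M
    quartic-blockAvg-≤ = begin
      quartic (blockAvg M p q)     ≡⟨ quartic-cong blockAvg≈avg⊗M⊗avg ⟩
      quartic (avg p ⊗ M ⊗ avg q)  ≤⟨ quartic-⊗-projʳ (isOrthogonalProjection q) (avg p ⊗ M) ⟩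
      quartic (avg p ⊗ M)          ≤⟨ quartic-⊗-projˡ (isOrthogonalProjection p) M ⟩
      quartic M                    ∎
      where open ≤-Reasoning

lemma12 : (F : OrderedField) → let open OrderedField F in let open Mat F in
    (K k l : ℕ) (M : Matrix K) (p : Fin K → Fin k) (q : Fin K → Fin l) →
    Surjective p → Surjective q →
    let N = blockAvg M p q in
    (Tr (M ⊗ (M ᵀ) ⊗ M ⊗ (M ᵀ)) ≡ Tr ((M ᵀ) ⊗ M ⊗ (M ᵀ) ⊗ M))
    × (Tr (N ⊗ (N ᵀ) ⊗ N ⊗ (N ᵀ)) ≤ Tr (M ⊗ (M ᵀ) ⊗ M ⊗ (M ᵀ)))
    × (Tr (N ⊗ (N ᵀ) ⊗ N ⊗ (N ᵀ)) ≡ Tr ((N ᵀ) ⊗ N ⊗ (N ᵀ) ⊗ N))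
lemma12 F K k l M p q _ _ =
  sym (quartic-ᵀ M) , quartic-blockAvg-≤ M p q , sym (quartic-ᵀ (Mat.blockAvg F M p q))
  where open BlockAveraging F
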